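{- Let $k\ge1$ and $1\le r\le(2k+1)^2$. Let $\overline{\mathcal{B}}(2k+1,2k+1;r)$ be the set of boards in $\mathcal{B}(2k+1,2k+1;r)$ whose board partition $\begin{pmatrix}\lambda_1&\lambda_2&\lambda_3&\lambda_4\\ \delta_1&\delta_2&\delta_3&\delta_4\end{pmatrix}_c$ satisfies: (i) $\lambda_1\ge\lambda_i$ for all $i>1$; (ii) $\lambda_2\ge\lambda_4$; (iii) if $\lambda_1=\lambda_2$ then $\lambda_3\ge\lambda_4$; (iv) if $\lambda_1=\lambda_3$ and $\lambda_2\ne\lambda_4$ then $\delta_1\ge\delta_2$, and if moreover $\delta_1=\delta_2$ then $\delta_3\ge\delta_4$; (v) if $\lambda_2=\lambda_4$ and $\lambda_1\ne\lambda_3$ then $\delta_1\ge\delta_4$, and if moreover $\delta_1=\delta_4$ then $\delta_2\ge\delta_3$; (vi) if $\lambda_1=\lambda_2>\lambda_3=\lambda_4$ then $\delta_2\ge\delta_4$; (vii) if $\lambda_1=\lambda_3>\lambda_2=\lambda_4$ then $\delta_1\ge\delta_i$ for all $i$, if $\delta_1=\delta_2$ then $\delta_3\ge\delta_4$, if $\delta_1=\delta_3$ then $\delta_2\ge\delta_4$, and if $\delta_1=\delta_4$ then $\delta_2\ge\delta_3$; (viii) if $\lambda_1=\lambda_2=\lambda_3=\lambda_4$ then $\delta_1\ge\delta_i$ for all $i$, $\delta_2\ge\delta_4$, and if $\delta_1=\delta_2$ then $\delta_3\ge\delta_4$. Then: (1) $\overline{\mathcal{B}}(2k+1,2k+1;r)$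 is the disjoint union of the sets of all boards of $\mathcal{B}(2k+1,2k+1;r)$ having a given board partition, over finitely many board partitions; (2) every board in $\mathcal{B}(2k+1,2k+1;r)$ is equivalent under $D_4$ to some board in $\overline{\mathcal{B}}(2k+1,2k+1;r)$; (3) any two boards in $\overline{\mathcal{B}}(2k+1,2k+1;r)$ equivalent under $D_4$ have the same board partition.
   Context: A $(2k+1)\times(2k+1)$ grid has cells $(i,j)$, $1\le i,j\le 2k+1$ ($i$ = row from top, $j$ = column from left). $\mathcal{B}(2k+1,2k+1;r)$ is the set of all choices of exactly $r$ blocked cells. $D_4$ acts on boards by the rotations $R_0,R_{90},R_{180},R_{270}$ about the center and the reflections $H,V$ (horizontal, vertical midlines), $D$ (main diagonal, top-left to bottom-right), $D'$ (other diagonal). Boards are equivalent if one is an image of the other. The grid is divided into nine regions: upper-left corner (rows $1..k$, columns $1..k$), top strip (rows $1..k$, column $k+1$), upper-right corner (rows $1..k$, columns $k+2..2k+1$), right strip (row $k+1$, columns $k+2..2k+1$), lower-right corner (rows $k+2..2k+1$, columns $k+2..2k+1$), bottom strip (rows $k+2..2k+1$, column $k+1$), lower-left corner (rows $k+2..2k+1$, columns $1..k$), left strip (row $k+1$, columns $1..k$), and center cell $(k+1,k+1)$. The board partition $\begin{pmatrix}\lambda_1&\lambda_2&\lambda_3&\lambda_4\\ \delta_1&\delta_2&\delta_3&\delta_4\end{pmatrix}_c$ records the numbers of blocked cells: $\lambda_1,\lambda_2,\lambda_3,\lambda_4$ in the upper-left, upper-right, lower-right, lower-left corners; $\delta_1,\delta_2,\delta_3,\delta_4$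 in the top, right, bottom, left strips; $c\in\{0,1\}$ in the center. -}

module Defs where

open import Data.Nat using (ℕ; zero; suc; _+_; _*_; _≤_; _<_; _≥_; _>_; _<ᵇ_; _≡ᵇ_)
open import Data.Bool using (Bool; true; false; _∧_; if_then_else_)
open import Data.Fin using (Fin; toℕ; opposite)
open import Data.Product using (Σ; _×_; _,_; proj₁; proj₂)
open import Relation.Binary.PropositionalEquality using (_≡_; _≢_)

-- Side length of the grid: n = 2k+1. Cells are indexed from 0 (Fin n),
-- so paper row i corresponds to Fin index i-1; the middle index is k.
side : ℕ → ℕ
side k = 2 * k + 1

-- A board: the predicate "cell (i,j) is blocked".
record Board (k : ℕ) : Set where
  constructor mkBoard
  field
    cell : Fin (side k) → Fin (side k) → Bool
open Board public

∑ : ∀ {n} → (Fin n → ℕ) → ℕ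
∑ {zero}  f = 0
∑ {suc n} f = f Fin.zero + ∑ (λ i → f (Fin.suc i))

ind : Bool → ℕ
ind true  = 1
ind false = 0

countIn : ∀ {k} → (Fin (side k) → Bool) → (Fin (side k) → Bool) → Board k → ℕ
countIn R C b = ∑ (λ i → ∑ (λ j → ind (R i ∧ C j ∧ cell b i j)))

always : ∀ {n} → Fin n → Bool
always _ = true

-- number of blocked cells (|B| = r means b ∈ 𝓑(2k+1,2k+1;r))
blocked : ∀ {k} → Board k → ℕ
blocked b = countIn always always b

lo mid hi : ∀ {k} → Fin (side k) → Bool
lo  {k} i = toℕ i <ᵇ k
mid {k} i = toℕ i ≡ᵇ k
hi  {k} i = k <ᵇ toℕ i

record Partition : Set where
  constructor mkPartition
  field
    l1 l2 l3 l4 d1 d2 d3 d4 c : ℕ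

partition : ∀ {k} → Board k → Partition
partition {k} b = mkPartition
  (countIn (lo {k}) (lo {k}) b)
  (countIn (lo {k}) (hi {k}) b)
  (countIn (hi {k}) (hi {k}) b)
  (countIn (hi {k}) (lo {k}) b)
  (countIn (lo {k}) (mid {k}) b)
  (countIn (mid {k}) (hi {k}) b)
  (countIn (hi {k}) (mid {k}) b)
  (countIn (mid {k}) (lo {k}) b)
  (countIn (mid {k}) (mid {k}) b)

Conditions : Partition → Set
Conditions p =
    (l1 ≥ l2 × l1 ≥ l3 × l1 ≥ l4)
  × (l2 ≥ l4)
  × (l1 ≡ l2 → l3 ≥ l4)
  × (l1 ≡ l3 → l2 ≢ l4 → d1 ≥ d2 × (d1 ≡ d2 → d3 ≥ d4))
  × (l2 ≡ l4 → l1 ≢ l3 → d1 ≥ d4 × (d1 ≡ d4 → d2 ≥ d3))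
  × (l1 ≡ l2 → l2 > l3 → l3 ≡ l4 → d2 ≥ d4)
  × (l1 ≡ l3 → l3 > l2 → l2 ≡ l4 →
        (d1 ≥ d1 × d1 ≥ d2 × d1 ≥ d3 × d1 ≥ d4)
      × (d1 ≡ d2 → d3 ≥ d4) × (d1 ≡ d3 → d2 ≥ d4) × (d1 ≡ d4 → d2 ≥ d3))
  × (l1 ≡ l2 → l2 ≡ l3 → l3 ≡ l4 →
        (d1 ≥ d1 × d1 ≥ d2 × d1 ≥ d3 × d1 ≥ d4)
      × d2 ≥ d4 × (d1 ≡ d2 → d3 ≥ d4))
  where open Partition p

-- membership in \overline{𝓑}(2k+1,2k+1;r) (together with blocked b ≡ r)
InBbar : ∀ {k} → Board k → Set
InBbar b = Conditions (partition b)

data D4 : Set where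
  R0 R90 R180 R270 H V D D' : D4

-- action on cells (i = row, j = column; opposite i = 2k - i)
act : ∀ {n} → D4 → Fin n → Fin n → Fin n × Fin n
act R0   i j = i , j
act R90  i j = j , opposite i
act R180 i j = opposite i , opposite j
act R270 i j = opposite j , i
act H    i j = opposite i , j
act V    i j = i , opposite j
act D    i j = j , i
act D'   i j = opposite j , opposite i

-- image of a board under g (as a predicate it is b ∘ act g; since D4 is a
-- group, the set of all such images equals the D4-orbit of b)
image : ∀ {k} → D4 → Board k → Board k
image g b = mkBoard (λ i j → cell b (proj₁ (act g i j)) (proj₂ (act g i j)))

Equivalent : ∀ {k} → Board k → Board k → Set
Equivalent b b' = Σ D4 λ g → ∀ i j → cell b' i j ≡ cell (image g b) i j

-- A board collapses onto its nine regions as a 3 × 3 array of counts (its partition), and the image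
-- of the board under g ∈ D4 collapses onto the image of that array under g: the region of a cell is
-- compatible with reversing indices, and double sums are invariant under the symmetries of the square.
-- Conditions (i)–(viii) compare corner counts only with corner counts and strip counts only with strip
-- counts, so whether they hold for the images of a partition depends only on the relative order of its
-- four corner counts and of its four strip counts. Replacing every count by its rank in its family keeps
-- these orders and leaves entries in {0,…,3}, so the existence of an image satisfying the conditions and
-- its uniqueness reduce to an exhaustive check of 4⁸ partitions. Part (1) holds because every count is
-- at most (2k+1)², so the partitions satisfying the conditions can be listed.

module Submission where

open import Defs
open import Data.Bool using (Bool; true; false; T; not; _∧_; _∨_)
open import Data.Bool.ListAction using (all)
open import Data.Bool.Properties using (∧-assoc; ∧-comm; T-≡)
open import Data.Fin using (Fin; zero; suc; toℕ; opposite; punchIn)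
open import Data.Fin.Patterns using (0F; 1F; 2F; 3F)
open import Data.Fin.Permutation using (reverse)
open import Data.Fin.Properties using (opposite-prop; toℕ<n; any?; all?)
  renaming (_≟_ to _≟ᶠ_)
open import Data.List using (List; []; _∷_; map; filter; deduplicate; upTo)
open import Data.List.Effectful using (applicative)
open import Data.List.Membership.Propositional using (_∈_; lose)
open import Data.List.Membership.Propositional.Properties
  using (∈-map⁺; ⊛-∈↔; ∈-upTo⁺; ∈-filter⁺; ∈-filter⁻; ∈-deduplicate⁺; ∈-deduplicate⁻)
import Data.List.Relation.Unary.All as All
open import Data.List.Relation.Unary.All.Properties using (all⁺)
import Data.List.Relation.Unary.Any as Any
open import Data.List.Relation.Unary.Any using (here; there)
open import Data.List.Relation.Unary.Unique.Propositional using (Unique)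
open import Data.List.Relation.Unary.Unique.DecPropositional.Properties using (deduplicate-!)
open import Data.Nat using (ℕ; zero; suc; _+_; _*_; _∸_; _^_; _≤_; _<_; _≤ᵇ_; _<ᵇ_; _≡ᵇ_; z≤n; s≤s)
open import Data.Nat.Properties
  using ( _≤?_; _≟_; +-0-commutativeMonoid; ≤ᵇ-reflects-≤; <ᵇ-reflects-<; ≡ᵇ⇒≡; ≡⇒≡ᵇ; ≤ᵇ⇒≤; ≤⇒≤ᵇ; <⇒<ᵇ
        ; ≤-refl; ≤-reflexive; ≤-antisym; <⇒≤; <-≤-trans; <-irrefl; ≰⇒>; <⇒≱; ≮⇒≥; module ≤-Reasoning
        ; +-mono-≤; +-mono-<-≤; +-suc; +-comm; +-identityʳ; *-identityʳ; +-cancelˡ-≡; m∸n+n≡m; suc-injective)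
open import Data.Product using (Σ; ∃; _×_; _,_; proj₁; proj₂; uncurry)
open import Data.Product.Properties using (≡-dec)
open import Data.Vec using (Vec; lookup; tabulate)
open import Data.Vec.Properties using (tabulate-cong)
open import Data.Vec.Functional using (removeAt)
open import Effect.Applicative using (RawApplicative)
open import Level using (0ℓ)
open import Function using (_∘_; Inverse)
open import Function.Bundles using (_⇔_; mk⇔; Equivalence)
open import Relation.Binary.Definitions using (DecidableEquality)
open import Relation.Binary.PropositionalEquality
  using (_≡_; refl; sym; trans; cong; cong₂; subst; subst₂; module ≡-Reasoning)
open import Relation.Nullary using (Dec; contradiction)
open import Relation.Nullary.Decidable
  using (does; proof; map′; _×-dec_; _→-dec_; ¬?; toWitness; isYes≗does; from-yes)
open import Relation.Nullary.Reflects using (Reflects; ofʸ; ofⁿ; det; fromEquivalence)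
open import Relation.Unary using (Decidable)

open import Algebra.Properties.CommutativeMonoid.Sum +-0-commutativeMonoid
  using (sum; sum-syntax; sum-cong-≗; sum-remove; ∑-comm; ∑-permute)
open RawApplicative (applicative {0ℓ}) using (_⊛_)

reflects-≡ : ∀ {A B : Set} {a b} → Reflects A a → Reflects B b → A ⇔ B → a ≡ b
reflects-≡ ra (ofʸ y) A⇔B = det ra (ofʸ (Equivalence.from A⇔B y))
reflects-≡ ra (ofⁿ ¬y) A⇔B = det ra (ofⁿ (¬y ∘ Equivalence.to A⇔B))

does-sound : ∀ {A : Set} (a? : Dec A) → T (does a?) → A
does-sound a? = toWitness ∘ subst T (sym (isYes≗does a?))

reflects-→ : ∀ {A B : Set} {b} → Reflects A b → Reflects B b → A → B
reflects-→ _        (ofʸ y) _ = y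
reflects-→ (ofⁿ ¬x) (ofⁿ _) x = contradiction x ¬x

∑≡sum : ∀ {n} (f : Fin n → ℕ) → ∑ f ≡ sum f
∑≡sum {zero}  f = refl
∑≡sum {suc n} f = cong (f zero +_) (∑≡sum (f ∘ suc))

sum-mono-≤ : ∀ {n} {f g : Fin n → ℕ} → (∀ i → f i ≤ g i) → sum f ≤ sum g
sum-mono-≤ {zero}  f≤g = z≤n
sum-mono-≤ {suc n} f≤g = +-mono-≤ (f≤g zero) (sum-mono-≤ (f≤g ∘ suc))

sum-≤ : ∀ {n c} {f : Fin n → ℕ} → (∀ i → f i ≤ c) → sum f ≤ n * c
sum-≤ {zero}  f≤c = z≤n
sum-≤ {suc n} f≤c = +-mono-≤ (f≤c zero) (sum-≤ (f≤c ∘ suc))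

sum-mono-< : ∀ {n} {f g : Fin (suc n) → ℕ} i → (∀ j → f j ≤ g j) → f i < g i → sum f < sum g
sum-mono-< {f = f} {g} i f≤g fi<gi = begin-strict
  sum f                     ≡⟨ sum-remove {i = i} f ⟩
  f i + sum (removeAt f i)  <⟨ +-mono-<-≤ fi<gi (sum-mono-≤ (f≤g ∘ punchIn i)) ⟩
  g i + sum (removeAt g i)  ≡⟨ sum-remove {i = i} g ⟨
  sum g                     ∎
  where open ≤-Reasoning

doubleSum : ∀ {m n} → (Fin m → Fin n → ℕ) → ℕ
doubleSum {m} {n} F = ∑[ i < m ] ∑[ j < n ] F i j

doubleSum-cong : ∀ {m n} {F G : Fin m → Fin n → ℕ} → (∀ i j → F i j ≡ G i j) → doubleSum F ≡ doubleSum G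
doubleSum-cong F≗G = sum-cong-≗ (λ i → sum-cong-≗ (F≗G i))

doubleSum-transpose : ∀ {n} (F : Fin n → Fin n → ℕ) → doubleSum (λ i j → F j i) ≡ doubleSum F
doubleSum-transpose F = sym (∑-comm F)

doubleSum-reverseRows : ∀ {m n} (F : Fin m → Fin n → ℕ) → doubleSum (F ∘ opposite) ≡ doubleSum F
doubleSum-reverseRows F = sym (∑-permute (λ i → sum (F i)) reverse)

doubleSum-reverseColumns : ∀ {m n} (F : Fin m → Fin n → ℕ) → doubleSum (λ i → F i ∘ opposite) ≡ doubleSum F
doubleSum-reverseColumns F = sum-cong-≗ (λ i → sym (∑-permute (F i) reverse))

doubleSum-act : ∀ {n} g (F : Fin n → Fin n → ℕ) → doubleSum (λ i j → uncurry F (act g i j)) ≡ doubleSum F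
doubleSum-act R0   F = refl
doubleSum-act R90  F = trans (doubleSum-reverseRows (λ i j → F j i)) (doubleSum-transpose F)
doubleSum-act R180 F = trans (doubleSum-reverseColumns (F ∘ opposite)) (doubleSum-reverseRows F)
doubleSum-act R270 F = trans (doubleSum-reverseColumns (λ i j → F j i)) (doubleSum-transpose F)
doubleSum-act H    F = doubleSum-reverseRows F
doubleSum-act V    F = doubleSum-reverseColumns F
doubleSum-act D    F = doubleSum-transpose F
doubleSum-act D'   F = begin
  doubleSum (λ i j → F (opposite j) (opposite i))  ≡⟨ doubleSum-reverseColumns (λ i j → F j (opposite i)) ⟩
  doubleSum (λ i j → F j (opposite i))             ≡⟨ doubleSum-reverseRows (λ i j → F j i) ⟩
  doubleSum (λ i j → F j i)                        ≡⟨ doubleSum-transpose F ⟩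
  doubleSum F                                      ∎
  where open ≡-Reasoning

countIn-doubleSum : ∀ {k} R C (b : Board k) → countIn R C b ≡ doubleSum (λ i j → ind (R i ∧ C j ∧ cell b i j))
countIn-doubleSum R C b =
  trans (∑≡sum (λ i → ∑ (λ j → ind (R i ∧ C j ∧ cell b i j))))
        (sum-cong-≗ (λ i → ∑≡sum (λ j → ind (R i ∧ C j ∧ cell b i j))))

countIn-cong : ∀ {k} R C {b b′ : Board k} → (∀ i j → cell b i j ≡ cell b′ i j) → countIn R C b ≡ countIn R C b′
countIn-cong R C {b} {b′} same = begin
  countIn R C b                                        ≡⟨ countIn-doubleSum R C b ⟩
  doubleSum (λ i j → ind (R i ∧ C j ∧ cell b i j))    ≡⟨ doubleSum-cong (λ i j → cong (λ x → ind (R i ∧ C j ∧ x)) (same i j)) ⟩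
  doubleSum (λ i j → ind (R i ∧ C j ∧ cell b′ i j))   ≡⟨ countIn-doubleSum R C b′ ⟨
  countIn R C b′                                       ∎
  where open ≡-Reasoning

countIn-image : ∀ {k} g (R C R′ C′ : Fin (side k) → Bool) (b : Board k) →
  (∀ i j → (R i ∧ C j) ≡ (R′ (proj₁ (act g i j)) ∧ C′ (proj₂ (act g i j)))) →
  countIn R C (image g b) ≡ countIn R′ C′ b
countIn-image {k} g R C R′ C′ b regions = begin
  countIn R C (image g b)                                     ≡⟨ countIn-doubleSum R C (image g b) ⟩
  doubleSum (λ i j → ind (R i ∧ C j ∧ cell (image g b) i j))  ≡⟨ doubleSum-cong (λ i j → cong ind (moved i j)) ⟩
  doubleSum (λ i j → uncurry F (act g i j))                   ≡⟨ doubleSum-act g F ⟩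
  doubleSum F                                                 ≡⟨ countIn-doubleSum R′ C′ b ⟨
  countIn R′ C′ b                                             ∎
  where
  open ≡-Reasoning
  F : Fin (side k) → Fin (side k) → ℕ
  F x y = ind (R′ x ∧ C′ y ∧ cell b x y)
  moved : ∀ i j → (R i ∧ C j ∧ cell (image g b) i j) ≡ uncurry (λ x y → R′ x ∧ C′ y ∧ cell b x y) (act g i j)
  moved i j = begin
    R i ∧ C j ∧ cell b x y          ≡⟨ ∧-assoc (R i) (C j) _ ⟨
    (R i ∧ C j) ∧ cell b x y        ≡⟨ cong (_∧ cell b x y) (regions i j) ⟩
    (R′ x ∧ C′ y) ∧ cell b x y      ≡⟨ ∧-assoc (R′ x) (C′ y) _ ⟩
    R′ x ∧ C′ y ∧ cell b x y        ∎
    where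
    x y : Fin (side k)
    x = proj₁ (act g i j)
    y = proj₂ (act g i j)

ind≤1 : ∀ b → ind b ≤ 1
ind≤1 false = z≤n
ind≤1 true  = s≤s z≤n

countIn-≤ : ∀ {k} R C (b : Board k) → countIn R C b ≤ side k * side k
countIn-≤ {k} R C b = begin
  countIn R C b                                      ≡⟨ countIn-doubleSum R C b ⟩
  doubleSum (λ i j → ind (R i ∧ C j ∧ cell b i j))  ≤⟨ sum-≤ (λ i → sum-≤ (λ j → ind≤1 (R i ∧ C j ∧ cell b i j))) ⟩
  side k * (side k * 1)                              ≡⟨ cong (side k *_) (*-identityʳ (side k)) ⟩
  side k * side k                                    ∎
  where open ≤-Reasoning

toℕ-opposite+toℕ : ∀ {k} (i : Fin (side k)) → toℕ (opposite i) + toℕ i ≡ k + k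
toℕ-opposite+toℕ {k} i = suc-injective (begin
  suc (toℕ (opposite i) + toℕ i)      ≡⟨ +-suc _ (toℕ i) ⟨
  toℕ (opposite i) + suc (toℕ i)      ≡⟨ cong (_+ suc (toℕ i)) (opposite-prop i) ⟩
  side k ∸ suc (toℕ i) + suc (toℕ i)  ≡⟨ m∸n+n≡m (toℕ<n i) ⟩
  2 * k + 1                           ≡⟨ +-comm (2 * k) 1 ⟩
  suc (k + (k + 0))                   ≡⟨ cong (λ m → suc (k + m)) (+-identityʳ k) ⟩
  suc (k + k)                         ∎)
  where open ≡-Reasoning

toℕ+toℕ-opposite : ∀ {k} (i : Fin (side k)) → toℕ i + toℕ (opposite i) ≡ k + k
toℕ+toℕ-opposite {k} i = trans (+-comm (toℕ i) _) (toℕ-opposite+toℕ {k} i)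

below-mirror : ∀ {a b k} → a + b ≡ k + k → a < k → k < b
below-mirror a+b≡k+k a<k = ≰⇒> (λ b≤k → <-irrefl a+b≡k+k (+-mono-<-≤ a<k b≤k))

above-mirror : ∀ {a b k} → a + b ≡ k + k → k < a → b < k
above-mirror a+b≡k+k k<a = ≰⇒> (λ k≤b → <-irrefl (sym a+b≡k+k) (+-mono-<-≤ k<a k≤b))

middle-mirror : ∀ {a b k} → a + b ≡ k + k → a ≡ k → b ≡ k
middle-mirror {a} {b} {k} a+b≡k+k a≡k = +-cancelˡ-≡ k b k (trans (cong (_+ b) (sym a≡k)) a+b≡k+k)

inBand : ∀ {k} → Fin 3 → Fin (side k) → Bool
inBand {k} 0F = lo {k}
inBand {k} 1F = mid {k}
inBand {k} 2F = hi {k}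

inBand-opposite : ∀ {k} β (i : Fin (side k)) → inBand {k} (opposite β) (opposite i) ≡ inBand {k} β i
inBand-opposite {k} 0F i = reflects-≡ (<ᵇ-reflects-< k _) (<ᵇ-reflects-< _ k)
  (mk⇔ (above-mirror (toℕ-opposite+toℕ {k} i)) (below-mirror (toℕ+toℕ-opposite {k} i)))
inBand-opposite {k} 1F i = reflects-≡ (≡ᵇ-reflects-≡ (toℕ (opposite i)) k) (≡ᵇ-reflects-≡ (toℕ i) k)
  (mk⇔ (middle-mirror (toℕ-opposite+toℕ {k} i)) (middle-mirror (toℕ+toℕ-opposite {k} i)))
  where
  ≡ᵇ-reflects-≡ : ∀ m n → Reflects (m ≡ n) (m ≡ᵇ n)
  ≡ᵇ-reflects-≡ m n = fromEquivalence (≡ᵇ⇒≡ m n) (≡⇒≡ᵇ m n)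
inBand-opposite {k} 2F i = reflects-≡ (<ᵇ-reflects-< _ k) (<ᵇ-reflects-< k _)
  (mk⇔ (below-mirror (toℕ-opposite+toℕ {k} i)) (above-mirror (toℕ+toℕ-opposite {k} i)))

Sector : Set
Sector = Fin 3 × Fin 3

inSector : ∀ {k} → Sector → Fin (side k) × Fin (side k) → Bool
inSector {k} (β , γ) (i , j) = inBand {k} β i ∧ inBand {k} γ j

inSector-act : ∀ {k} g (s : Sector) (x : Fin (side k) × Fin (side k)) →
  inSector {k} (uncurry (act g) s) (uncurry (act g) x) ≡ inSector {k} s x
inSector-act {k} R0   s        x       = refl
inSector-act {k} R90  (β , γ) (i , j) = trans (cong (inBand {k} γ j ∧_) (inBand-opposite β i)) (∧-comm (inBand {k} γ j) _)
inSector-act {k} R180 (β , γ) (i , j) = cong₂ _∧_ (inBand-opposite β i) (inBand-opposite γ j)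
inSector-act {k} R270 (β , γ) (i , j) = trans (cong (_∧ inBand {k} β i) (inBand-opposite γ j)) (∧-comm (inBand {k} γ j) _)
inSector-act {k} H    (β , γ) (i , j) = cong (_∧ inBand {k} γ j) (inBand-opposite β i)
inSector-act {k} V    (β , γ) (i , j) = cong (inBand {k} β i ∧_) (inBand-opposite γ j)
inSector-act {k} D    (β , γ) (i , j) = ∧-comm (inBand {k} γ j) _
inSector-act {k} D'   (β , γ) (i , j) = trans (cong₂ _∧_ (inBand-opposite γ j) (inBand-opposite β i)) (∧-comm (inBand {k} γ j) _)

-- Board partitions as 3 × 3 arrays

-- The partition laid out as the array ((λ₁ δ₁ λ₂) (δ₄ c δ₂) (λ₄ δ₃ λ₃)), indexed by row and column band.
entry : Partition → Sector → ℕ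
entry p (0F , 0F) = Partition.l1 p
entry p (0F , 1F) = Partition.d1 p
entry p (0F , 2F) = Partition.l2 p
entry p (1F , 0F) = Partition.d4 p
entry p (1F , 1F) = Partition.c p
entry p (1F , 2F) = Partition.d2 p
entry p (2F , 0F) = Partition.l4 p
entry p (2F , 1F) = Partition.d3 p
entry p (2F , 2F) = Partition.l3 p

fromEntries : (Sector → ℕ) → Partition
fromEntries m = mkPartition
  (m (0F , 0F)) (m (0F , 2F)) (m (2F , 2F)) (m (2F , 0F))
  (m (0F , 1F)) (m (1F , 2F)) (m (2F , 1F)) (m (1F , 0F)) (m (1F , 1F))

entry-fromEntries : ∀ m s → entry (fromEntries m) s ≡ m s
entry-fromEntries m (0F , 0F) = refl
entry-fromEntries m (0F , 1F) = refl
entry-fromEntries m (0F , 2F) = refl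
entry-fromEntries m (1F , 0F) = refl
entry-fromEntries m (1F , 1F) = refl
entry-fromEntries m (1F , 2F) = refl
entry-fromEntries m (2F , 0F) = refl
entry-fromEntries m (2F , 1F) = refl
entry-fromEntries m (2F , 2F) = refl

-- Both numbered clockwise from the top left, so that cornersOf p lists λ₁ … λ₄ and stripsOf p lists δ₁ … δ₄.
corner strip : Fin 4 → Sector
corner 0F = 0F , 0F
corner 1F = 0F , 2F
corner 2F = 2F , 2F
corner 3F = 2F , 0F
strip 0F = 0F , 1F
strip 1F = 1F , 2F
strip 2F = 2F , 1F
strip 3F = 1F , 0F

centre : Sector
centre = 1F , 1F

cornersOf stripsOf : Partition → Fin 4 → ℕ
cornersOf p = entry p ∘ corner
stripsOf  p = entry p ∘ strip

partition-ext : ∀ {p q} → (∀ i → cornersOf p i ≡ cornersOf q i) → (∀ i → stripsOf p i ≡ stripsOf q i) →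
  Partition.c p ≡ Partition.c q → p ≡ q
partition-ext {mkPartition _ _ _ _ _ _ _ _ _} {mkPartition _ _ _ _ _ _ _ _ _} Λ= Δ= refl
  with Λ= 0F | Λ= 1F | Λ= 2F | Λ= 3F | Δ= 0F | Δ= 1F | Δ= 2F | Δ= 3F
... | refl | refl | refl | refl | refl | refl | refl | refl = refl

entries-ext : ∀ {p q} → (∀ s → entry p s ≡ entry q s) → p ≡ q
entries-ext p≗q = partition-ext (p≗q ∘ corner) (p≗q ∘ strip) (p≗q centre)

_≟ᴾ_ : DecidableEquality Partition
p ≟ᴾ q = map′ (λ (Λ= , Δ= , c=) → partition-ext Λ= Δ= c=) (λ { refl → (λ _ → refl) , (λ _ → refl) , refl })
  (all? (λ i → cornersOf p i ≟ cornersOf q i) ×-dec all? (λ i → stripsOf p i ≟ stripsOf q i) ×-dec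
   Partition.c p ≟ Partition.c q)

regionCount : ∀ {k} → Board k → Sector → ℕ
regionCount {k} b (β , γ) = countIn (inBand {k} β) (inBand {k} γ) b

-- partition b is definitionally fromEntries (regionCount b).
entry-partition : ∀ {k} (b : Board k) s → entry (partition b) s ≡ regionCount b s
entry-partition b = entry-fromEntries (regionCount b)

imageᴾ : D4 → Partition → Partition
imageᴾ g p = fromEntries (entry p ∘ uncurry (act g))

entry-imageᴾ : ∀ g p s → entry (imageᴾ g p) s ≡ entry p (uncurry (act g) s)
entry-imageᴾ g p = entry-fromEntries (entry p ∘ uncurry (act g))

regionCount-image : ∀ {k} g (b : Board k) s → regionCount (image g b) s ≡ regionCount b (uncurry (act g) s)
regionCount-image {k} g b s@(β , γ) = countIn-image g (inBand {k} β) (inBand {k} γ) (inBand {k} β′) (inBand {k} γ′) b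
  (λ i j → sym (inSector-act {k} g s (i , j)))
  where
  β′ γ′ : Fin 3
  β′ = proj₁ (act g β γ)
  γ′ = proj₂ (act g β γ)

partition-image : ∀ {k} g (b : Board k) → partition (image g b) ≡ imageᴾ g (partition b)
partition-image {k} g b = entries-ext same-entry
  where
  open ≡-Reasoning
  same-entry : ∀ s → entry (partition (image g b)) s ≡ entry (imageᴾ g (partition b)) s
  same-entry s@(β , γ) = begin
    entry (partition (image g b)) s          ≡⟨ entry-partition (image g b) s ⟩
    regionCount (image g b) s                ≡⟨ regionCount-image g b s ⟩
    regionCount b (act g β γ)                ≡⟨ entry-partition b (act g β γ) ⟨
    entry (partition b) (act g β γ)          ≡⟨ entry-imageᴾ g (partition b) s ⟨
    entry (imageᴾ g (partition b)) s         ∎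

blocked-image : ∀ {k} g (b : Board k) → blocked (image g b) ≡ blocked b
blocked-image g b = countIn-image g always always always always b (λ i j → refl)

partition-cong : ∀ {k} {b b′ : Board k} → (∀ i j → cell b i j ≡ cell b′ i j) → partition b ≡ partition b′
partition-cong {k} {b} {b′} same = entries-ext λ s → begin
  entry (partition b) s   ≡⟨ entry-partition b s ⟩
  regionCount b s         ≡⟨ countIn-cong {k} (inBand {k} (proj₁ s)) (inBand {k} (proj₂ s)) same ⟩
  regionCount b′ s        ≡⟨ entry-partition b′ s ⟨
  entry (partition b′) s  ∎
  where open ≡-Reasoning

-- Order types

-- Unlike comparison functions, tables can be compared by _≡_, so a Boolean formula in the table entries
-- transfers along SameOrder by cong.
OrderTable : ℕ → Set
OrderTable n = Vec (Vec Bool n) n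

orderTable : ∀ {n} → (Fin n → ℕ) → OrderTable n
orderTable f = tabulate λ i → tabulate λ j → f i ≤ᵇ f j

record SameOrder {n} (f g : Fin n → ℕ) : Set where
  constructor sameOrder
  field agree : ∀ i j → (f i ≤ᵇ f j) ≡ (g i ≤ᵇ g j)

open SameOrder

orderTable-cong : ∀ {n} {f g : Fin n → ℕ} → SameOrder f g → orderTable f ≡ orderTable g
orderTable-cong f∼g = tabulate-cong λ i → tabulate-cong (agree f∼g i)

SameOrder-sym : ∀ {n} {f g : Fin n → ℕ} → SameOrder f g → SameOrder g f
SameOrder-sym f∼g = sameOrder λ i j → sym (agree f∼g i j)

SameOrder-reindex : ∀ {m n} {f g : Fin n → ℕ} {f′ g′ : Fin m → ℕ} (π : Fin m → Fin n) →
  (∀ i → f′ i ≡ f (π i)) → (∀ i → g′ i ≡ g (π i)) → SameOrder f g → SameOrder f′ g′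
SameOrder-reindex {f = f} {g} {f′} {g′} π f′≗fπ g′≗gπ f∼g = sameOrder λ i j → begin
  f′ i ≤ᵇ f′ j          ≡⟨ cong₂ _≤ᵇ_ (f′≗fπ i) (f′≗fπ j) ⟩
  f (π i) ≤ᵇ f (π j)    ≡⟨ agree f∼g (π i) (π j) ⟩
  g (π i) ≤ᵇ g (π j)    ≡⟨ cong₂ _≤ᵇ_ (g′≗gπ i) (g′≗gπ j) ⟨
  g′ i ≤ᵇ g′ j          ∎
  where open ≡-Reasoning

SameOrder-≡ : ∀ {n} {f g : Fin n → ℕ} → SameOrder f g → ∀ i j → g i ≡ g j → f i ≡ f j
SameOrder-≡ {f = f} {g} f∼g i j gi≡gj = ≤-antisym (≤-transfer i j gi≡gj) (≤-transfer j i (sym gi≡gj))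
  where
  ≤-transfer : ∀ i j → g i ≡ g j → f i ≤ f j
  ≤-transfer i j gi≡gj = ≤ᵇ⇒≤ _ _ (subst T (sym (agree f∼g i j)) (≤⇒≤ᵇ (≤-reflexive gi≡gj)))

-- Decisions of _≡_ and _<_ whose outcome is a Boolean combination of _≤ᵇ_ alone.
_≡?_ : (m n : ℕ) → Dec (m ≡ n)
m ≡? n = map′ (uncurry ≤-antisym) (λ m≡n → ≤-reflexive m≡n , ≤-reflexive (sym m≡n)) (m ≤? n ×-dec n ≤? m)

_<?_ : (m n : ℕ) → Dec (m < n)
m <? n = map′ ≰⇒> <⇒≱ (¬? (n ≤? m))

conditions? : ∀ p → Dec (Conditions p)
conditions? p =
      (l2 ≤? l1 ×-dec l3 ≤? l1 ×-dec l4 ≤? l1)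
  ×-dec l4 ≤? l2
  ×-dec (l1 ≡? l2 →-dec l4 ≤? l3)
  ×-dec (l1 ≡? l3 →-dec ¬? (l2 ≡? l4) →-dec d2 ≤? d1 ×-dec (d1 ≡? d2 →-dec d4 ≤? d3))
  ×-dec (l2 ≡? l4 →-dec ¬? (l1 ≡? l3) →-dec d4 ≤? d1 ×-dec (d1 ≡? d4 →-dec d3 ≤? d2))
  ×-dec (l1 ≡? l2 →-dec l3 <? l2 →-dec l3 ≡? l4 →-dec d4 ≤? d2)
  ×-dec (l1 ≡? l3 →-dec l2 <? l3 →-dec l2 ≡? l4 →-dec
          (d1 ≤? d1 ×-dec d2 ≤? d1 ×-dec d3 ≤? d1 ×-dec d4 ≤? d1)
          ×-dec (d1 ≡? d2 →-dec d4 ≤? d3) ×-dec (d1 ≡? d3 →-dec d4 ≤? d2) ×-dec (d1 ≡? d4 →-dec d3 ≤? d2))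
  ×-dec (l1 ≡? l2 →-dec l2 ≡? l3 →-dec l3 ≡? l4 →-dec
          (d1 ≤? d1 ×-dec d2 ≤? d1 ×-dec d3 ≤? d1 ×-dec d4 ≤? d1)
          ×-dec d4 ≤? d2 ×-dec (d1 ≡? d2 →-dec d4 ≤? d3))
  where open Partition p

_⇒_ : Bool → Bool → Bool
a ⇒ b = not a ∨ b

infixr 4 _⇒_
infix 7 _≤[_]_ _≡[_]_ _<[_]_

_≤[_]_ _≡[_]_ _<[_]_ : Fin 4 → OrderTable 4 → Fin 4 → Bool
i ≤[ t ] j = lookup (lookup t i) j
i ≡[ t ] j = i ≤[ t ] j ∧ j ≤[ t ] i
i <[ t ] j = not (j ≤[ t ] i)

conditionsᵇ : OrderTable 4 → OrderTable 4 → Bool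
conditionsᵇ Λ Δ =
    (1F ≤[ Λ ] 0F ∧ 2F ≤[ Λ ] 0F ∧ 3F ≤[ Λ ] 0F)
  ∧ 3F ≤[ Λ ] 1F
  ∧ (0F ≡[ Λ ] 1F ⇒ 3F ≤[ Λ ] 2F)
  ∧ (0F ≡[ Λ ] 2F ⇒ not (1F ≡[ Λ ] 3F) ⇒ 1F ≤[ Δ ] 0F ∧ (0F ≡[ Δ ] 1F ⇒ 3F ≤[ Δ ] 2F))
  ∧ (1F ≡[ Λ ] 3F ⇒ not (0F ≡[ Λ ] 2F) ⇒ 3F ≤[ Δ ] 0F ∧ (0F ≡[ Δ ] 3F ⇒ 2F ≤[ Δ ] 1F))
  ∧ (0F ≡[ Λ ] 1F ⇒ 2F <[ Λ ] 1F ⇒ 2F ≡[ Λ ] 3F ⇒ 3F ≤[ Δ ] 1F)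
  ∧ (0F ≡[ Λ ] 2F ⇒ 1F <[ Λ ] 2F ⇒ 1F ≡[ Λ ] 3F ⇒
       (0F ≤[ Δ ] 0F ∧ 1F ≤[ Δ ] 0F ∧ 2F ≤[ Δ ] 0F ∧ 3F ≤[ Δ ] 0F)
     ∧ (0F ≡[ Δ ] 1F ⇒ 3F ≤[ Δ ] 2F) ∧ (0F ≡[ Δ ] 2F ⇒ 3F ≤[ Δ ] 1F) ∧ (0F ≡[ Δ ] 3F ⇒ 2F ≤[ Δ ] 1F))
  ∧ (0F ≡[ Λ ] 1F ⇒ 1F ≡[ Λ ] 2F ⇒ 2F ≡[ Λ ] 3F ⇒
       (0F ≤[ Δ ] 0F ∧ 1F ≤[ Δ ] 0F ∧ 2F ≤[ Δ ] 0F ∧ 3F ≤[ Δ ] 0F)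
     ∧ 3F ≤[ Δ ] 1F ∧ (0F ≡[ Δ ] 1F ⇒ 3F ≤[ Δ ] 2F))

-- does (conditions? p) computes to this formula, by the choice of _≡?_ and _<?_.
conditionsᵇ-reflects : ∀ p → Reflects (Conditions p) (conditionsᵇ (orderTable (cornersOf p)) (orderTable (stripsOf p)))
conditionsᵇ-reflects p = proof (conditions? p)

SameOrderType : Partition → Partition → Set
SameOrderType p q = SameOrder (cornersOf p) (cornersOf q) × SameOrder (stripsOf p) (stripsOf q)

SameOrderType-sym : ∀ {p q} → SameOrderType p q → SameOrderType q p
SameOrderType-sym (Λ∼ , Δ∼) = SameOrder-sym Λ∼ , SameOrder-sym Δ∼

Conditions-respects : ∀ {p q} → SameOrderType p q → Conditions p → Conditions q
Conditions-respects {p} {q} (Λ∼ , Δ∼) = reflects-→ (conditionsᵇ-reflects p)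
  (subst (Reflects (Conditions q)) (sym (cong₂ conditionsᵇ (orderTable-cong Λ∼) (orderTable-cong Δ∼))) (conditionsᵇ-reflects q))

allD4 : List D4
allD4 = R0 ∷ R90 ∷ R180 ∷ R270 ∷ H ∷ V ∷ D ∷ D' ∷ []

∈-allD4 : ∀ g → g ∈ allD4
∈-allD4 R0   = here refl
∈-allD4 R90  = there (here refl)
∈-allD4 R180 = there (there (here refl))
∈-allD4 R270 = there (there (there (here refl)))
∈-allD4 H    = there (there (there (there (here refl))))
∈-allD4 V    = there (there (there (there (there (here refl)))))
∈-allD4 D    = there (there (there (there (there (there (here refl))))))
∈-allD4 D'   = there (there (there (there (there (there (there (here refl)))))))

∀-D4? : {P : D4 → Set} → Decidable P → Dec (∀ g → P g)
∀-D4? P? = map′ (λ every g → All.lookup every (∈-allD4 g)) (λ every → All.tabulate (λ {g} _ → every g)) (All.all? P? allD4)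

∃-D4? : {P : D4 → Set} → Decidable P → Dec (Σ D4 P)
∃-D4? P? = map′ Any.satisfied (λ (g , pg) → lose (∈-allD4 g) pg) (Any.any? P? allD4)

_≟ˢ_ : DecidableEquality Sector
_≟ˢ_ = ≡-dec _≟ᶠ_ _≟ᶠ_

-- Facts about the 3 × 3 grid decided by evaluation; opaque so that their proofs are never unfolded.
opaque
  corner-image : ∀ g i → ∃ λ j → uncurry (act g) (corner i) ≡ corner j
  corner-image = from-yes (∀-D4? λ g → all? λ i → any? λ j → uncurry (act g) (corner i) ≟ˢ corner j)

  strip-image : ∀ g i → ∃ λ j → uncurry (act g) (strip i) ≡ strip j
  strip-image = from-yes (∀-D4? λ g → all? λ i → any? λ j → uncurry (act g) (strip i) ≟ˢ strip j)

  centre-image : ∀ g → uncurry (act g) centre ≡ centre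
  centre-image = from-yes (∀-D4? λ g → uncurry (act g) centre ≟ˢ centre)

cornersOf-image : ∀ g p i → cornersOf (imageᴾ g p) i ≡ cornersOf p (proj₁ (corner-image g i))
cornersOf-image g p i = trans (entry-imageᴾ g p (corner i)) (cong (entry p) (proj₂ (corner-image g i)))

stripsOf-image : ∀ g p i → stripsOf (imageᴾ g p) i ≡ stripsOf p (proj₁ (strip-image g i))
stripsOf-image g p i = trans (entry-imageᴾ g p (strip i)) (cong (entry p) (proj₂ (strip-image g i)))

SameOrderType-image : ∀ g {p q} → SameOrderType p q → SameOrderType (imageᴾ g p) (imageᴾ g q)
SameOrderType-image g {p} {q} (Λ∼ , Δ∼) =
    SameOrder-reindex (proj₁ ∘ corner-image g) (cornersOf-image g p) (cornersOf-image g q) Λ∼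
  , SameOrder-reindex (proj₁ ∘ strip-image g) (stripsOf-image g p) (stripsOf-image g q) Δ∼

fixed-respects : ∀ g {p q} → SameOrderType p q → imageᴾ g q ≡ q → imageᴾ g p ≡ p
fixed-respects g {p} {q} (Λ∼ , Δ∼) gq≡q = partition-ext corners-fixed strips-fixed (cong (entry p) (centre-image g))
  where
  corners-fixed : ∀ i → cornersOf (imageᴾ g p) i ≡ cornersOf p i
  corners-fixed i = trans (cornersOf-image g p i) (SameOrder-≡ Λ∼ (proj₁ (corner-image g i)) i
    (trans (sym (cornersOf-image g q i)) (cong (λ r → cornersOf r i) gq≡q)))
  strips-fixed : ∀ i → stripsOf (imageᴾ g p) i ≡ stripsOf p i
  strips-fixed i = trans (stripsOf-image g p i) (SameOrder-≡ Δ∼ (proj₁ (strip-image g i)) i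
    (trans (sym (stripsOf-image g q i)) (cong (λ r → stripsOf r i) gq≡q)))

-- Ranks

rank : ∀ {n} → (Fin n → ℕ) → Fin n → ℕ
rank {n} f i = ∑[ j < n ] ind (f j <ᵇ f i)

<ᵇ-irrefl : ∀ m → (m <ᵇ m) ≡ false
<ᵇ-irrefl zero    = refl
<ᵇ-irrefl (suc m) = <ᵇ-irrefl m

ind-<ᵇ-monoʳ : ∀ a {m n} → m ≤ n → ind (a <ᵇ m) ≤ ind (a <ᵇ n)
ind-<ᵇ-monoʳ a {m} {n} m≤n with a <ᵇ m | <ᵇ-reflects-< a m | a <ᵇ n | <ᵇ-reflects-< a n
... | false | _        | _     | _        = z≤n
... | true  | _        | true  | _        = ≤-refl
... | true  | ofʸ a<m | false | ofⁿ a≮n = contradiction (<-≤-trans a<m m≤n) a≮n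

ind-<ᵇ : ∀ {m n} → m < n → ind (m <ᵇ n) ≡ 1
ind-<ᵇ m<n = cong ind (Equivalence.to T-≡ (<⇒<ᵇ m<n))

rank-mono : ∀ {n} (f : Fin n → ℕ) {i j} → f i ≤ f j → rank f i ≤ rank f j
rank-mono f fi≤fj = sum-mono-≤ (λ k → ind-<ᵇ-monoʳ (f k) fi≤fj)

rank-strict : ∀ {n} (f : Fin n → ℕ) {i j} → f i < f j → rank f i < rank f j
rank-strict {suc n} f {i} {j} fi<fj = sum-mono-< i (λ k → ind-<ᵇ-monoʳ (f k) (<⇒≤ fi<fj))
  (subst₂ _<_ (sym (cong ind (<ᵇ-irrefl (f i)))) (sym (ind-<ᵇ fi<fj)) (s≤s z≤n))

rank-≤ : ∀ {n} (f : Fin (suc n) → ℕ) i → rank f i ≤ n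
rank-≤ {n} f i = begin
  rank f i                          ≡⟨ sum-remove {i = i} below ⟩
  below i + sum (removeAt below i)  ≡⟨ cong (λ b → ind b + sum (removeAt below i)) (<ᵇ-irrefl (f i)) ⟩
  sum (removeAt below i)            ≤⟨ sum-≤ {n} (λ j → ind≤1 (f (punchIn i j) <ᵇ f i)) ⟩
  n * 1                             ≡⟨ *-identityʳ n ⟩
  n                                 ∎
  where
  open ≤-Reasoning
  below : Fin (suc n) → ℕ
  below j = ind (f j <ᵇ f i)

SameOrder-rank : ∀ {n} (f : Fin n → ℕ) → SameOrder f (rank f)
SameOrder-rank f = sameOrder λ i j → reflects-≡ (≤ᵇ-reflects-≤ (f i) (f j)) (≤ᵇ-reflects-≤ (rank f i) (rank f j))
  (mk⇔ (rank-mono f) (λ ri≤rj → ≮⇒≥ (λ fj<fi → <⇒≱ (rank-strict f fj<fi) ri≤rj)))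

rankNormal : Partition → Partition
rankNormal p = mkPartition (Λ 0F) (Λ 1F) (Λ 2F) (Λ 3F) (Δ 0F) (Δ 1F) (Δ 2F) (Δ 3F) 0
  where
  Λ Δ : Fin 4 → ℕ
  Λ = rank (cornersOf p)
  Δ = rank (stripsOf p)

cornersOf-rankNormal : ∀ p i → cornersOf (rankNormal p) i ≡ rank (cornersOf p) i
cornersOf-rankNormal p 0F = refl
cornersOf-rankNormal p 1F = refl
cornersOf-rankNormal p 2F = refl
cornersOf-rankNormal p 3F = refl

stripsOf-rankNormal : ∀ p i → stripsOf (rankNormal p) i ≡ rank (stripsOf p) i
stripsOf-rankNormal p 0F = refl
stripsOf-rankNormal p 1F = refl
stripsOf-rankNormal p 2F = refl
stripsOf-rankNormal p 3F = refl

SameOrderType-rankNormal : ∀ p → SameOrderType p (rankNormal p)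
SameOrderType-rankNormal p =
    SameOrder-reindex (λ i → i) (λ _ → refl) (cornersOf-rankNormal p) (SameOrder-rank (cornersOf p))
  , SameOrder-reindex (λ i → i) (λ _ → refl) (stripsOf-rankNormal p) (SameOrder-rank (stripsOf p))

-- The exhaustive check

partitionsOver : List ℕ → List ℕ → List Partition
partitionsOver xs cs = map mkPartition xs ⊛ xs ⊛ xs ⊛ xs ⊛ xs ⊛ xs ⊛ xs ⊛ xs ⊛ cs

∈-⊛ : ∀ {A B : Set} {fs : List (A → B)} {xs f x} → f ∈ fs → x ∈ xs → f x ∈ (fs ⊛ xs)
∈-⊛ {fs = fs} f∈fs x∈xs = Inverse.to (⊛-∈↔ fs) (_ , _ , f∈fs , x∈xs , refl)

∈-partitionsOver : ∀ {xs cs} p → (∀ i → cornersOf p i ∈ xs) → (∀ i → stripsOf p i ∈ xs) →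
  Partition.c p ∈ cs → p ∈ partitionsOver xs cs
∈-partitionsOver p Λ∈ Δ∈ c∈ =
  ∈-⊛ (∈-⊛ (∈-⊛ (∈-⊛ (∈-⊛ (∈-⊛ (∈-⊛ (∈-⊛ (∈-map⁺ mkPartition (Λ∈ 0F)) (Λ∈ 1F)) (Λ∈ 2F)) (Λ∈ 3F))
    (Δ∈ 0F)) (Δ∈ 1F)) (Δ∈ 2F)) (Δ∈ 3F)) c∈

Canonisable : Partition → Set
Canonisable p = Σ D4 (λ g → Conditions (imageᴾ g p))
              × (Conditions p → ∀ g → Conditions (imageᴾ g p) → imageᴾ g p ≡ p)

canonisable? : Decidable Canonisable
canonisable? p = ∃-D4? (λ g → conditions? (imageᴾ g p))
           ×-dec (conditions? p →-dec ∀-D4? (λ g → conditions? (imageᴾ g p) →-dec imageᴾ g p ≟ᴾ p))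

Canonisable-respects : ∀ {p q} → SameOrderType p q → Canonisable q → Canonisable p
Canonisable-respects p∼q ((g , gq-ok) , q-unique) =
    (g , Conditions-respects (SameOrderType-sym (SameOrderType-image g p∼q)) gq-ok)
  , λ p-ok g gp-ok → fixed-respects g p∼q
      (q-unique (Conditions-respects p∼q p-ok) g (Conditions-respects (SameOrderType-image g p∼q) gp-ok))

rankNormals : List Partition
rankNormals = partitionsOver (upTo 4) (0 ∷ [])

-- The check is evaluated once, in rankNormals-checked. The opaque blocks and the explicit implicit
-- arguments below keep unification from unfolding it again.
opaque
  canonisableᵇ : Partition → Bool
  canonisableᵇ p = does (canonisable? p)

  canonisableᵇ-sound : ∀ p → T (canonisableᵇ p) → Canonisable p
  canonisableᵇ-sound p = does-sound (canonisable? p)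

opaque
  unfolding canonisableᵇ
  rankNormals-checked : all canonisableᵇ rankNormals ≡ true
  rankNormals-checked = refl

rankNormals-canonisable : All.All Canonisable rankNormals
rankNormals-canonisable = All.map {P = T ∘ canonisableᵇ} {Q = Canonisable} (canonisableᵇ-sound _)
  (all⁺ canonisableᵇ rankNormals (subst T {x = true} {y = all canonisableᵇ rankNormals} (sym rankNormals-checked) _))

rankNormal-∈ : ∀ p → rankNormal p ∈ rankNormals
rankNormal-∈ p = ∈-partitionsOver {upTo 4} {0 ∷ []} (rankNormal p)
  (λ i → ∈-upTo⁺ (s≤s (subst (_≤ 3) (sym (cornersOf-rankNormal p i)) (rank-≤ (cornersOf p) i))))
  (λ i → ∈-upTo⁺ (s≤s (subst (_≤ 3) (sym (stripsOf-rankNormal p i)) (rank-≤ (stripsOf p) i))))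
  (here refl)

opaque
  canonisable : ∀ p → Canonisable p
  canonisable p = Canonisable-respects {p} {rankNormal p} (SameOrderType-rankNormal p)
    (All.lookup rankNormals-canonisable (rankNormal-∈ p))

canonical-image : ∀ p → Σ D4 λ g → Conditions (imageᴾ g p)
canonical-image = proj₁ ∘ canonisable

canonical-unique : ∀ p → Conditions p → ∀ g → Conditions (imageᴾ g p) → imageᴾ g p ≡ p
canonical-unique = proj₂ ∘ canonisable

canonical-board : ∀ {k} (b : Board k) → Σ D4 λ g → InBbar (image g b)
canonical-board b = let g , gb-ok = canonical-image (partition b) in
  g , subst Conditions (sym (partition-image g b)) gb-ok

canonical-board-unique : ∀ {k} {b b′ : Board k} → InBbar b → InBbar b′ → Equivalent b b′ → partition b ≡ partition b′
canonical-board-unique {k} {b} {b′} b-ok b′-ok (g , b′≗gb) =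
  sym (trans b′≡gb (canonical-unique (partition b) b-ok g (subst Conditions b′≡gb b′-ok)))
  where
  b′≡gb : partition b′ ≡ imageᴾ g (partition b)
  b′≡gb = trans (partition-cong {k} {b′} {image g b} b′≗gb) (partition-image g b)

entryRange : ℕ → List ℕ
entryRange k = upTo (suc (side k * side k))

satisfyingConditions : ℕ → List Partition
satisfyingConditions k = filter conditions? (partitionsOver (entryRange k) (entryRange k))

candidates : ℕ → List Partition
candidates k = deduplicate _≟ᴾ_ (satisfyingConditions k)

candidates-unique : ∀ k → Unique (candidates k)
candidates-unique k = deduplicate-! _≟ᴾ_ (satisfyingConditions k)

InBbar⇔∈candidates : ∀ {k} (b : Board k) → InBbar b ⇔ partition b ∈ candidates k
InBbar⇔∈candidates {k} b = mk⇔
  (λ b-ok → ∈-deduplicate⁺ _≟ᴾ_ (∈-filter⁺ conditions?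
    (∈-partitionsOver (partition b) (inRange ∘ corner) (inRange ∘ strip) (inRange centre)) b-ok))
  (λ b∈ → proj₂ (∈-filter⁻ conditions? {xs = partitionsOver (entryRange k) (entryRange k)}
    (∈-deduplicate⁻ _≟ᴾ_ (satisfyingConditions k) b∈)))
  where
  inRange : ∀ s → entry (partition b) s ∈ entryRange k
  inRange s = ∈-upTo⁺ (s≤s (subst (_≤ side k * side k) (sym (entry-partition b s))
    (countIn-≤ (inBand {k} (proj₁ s)) (inBand {k} (proj₂ s)) b)))

theorem4p3 : (k r : ℕ) → 1 ≤ k → 1 ≤ r → r ≤ (2 * k + 1) ^ 2 →
    (Σ (List Partition) λ Ps → Unique Ps ×
       ((b : Board k) → blocked b ≡ r → (InBbar b ⇔ (partition b ∈ Ps))))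
  × ((b : Board k) → blocked b ≡ r →
       Σ (Board k) λ b' → blocked b' ≡ r × InBbar b' × Equivalent b b')
  × ((b b' : Board k) → blocked b ≡ r → blocked b' ≡ r →
       InBbar b → InBbar b' → Equivalent b b' → partition b ≡ partition b')
theorem4p3 k r _ _ _ =
    (candidates k , candidates-unique k , λ b _ → InBbar⇔∈candidates b)
  , (λ b b-r → let g , gb-ok = canonical-board b in
       image g b , trans (blocked-image g b) b-r , gb-ok , g , λ i j → refl)
  , λ b b′ _ _ → canonical-board-unique {k}
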